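{- For every graph $G$ of diameter $d$, $\mathrm{adim}(G)\ge \mathrm{bdim}(G)\ge \frac{d}{3}$.
   Context: All graphs are finite, simple and undirected. For vertices $x,y$ of $G$, $d(x,y)$ is the length of a shortest $x$–$y$ path ($\infty$ if in different components); the diameter is $\max\{d(x,y):x,y\in V(G)\}$. For a positive integer $i$, $d_i(x,y)=\min\{d(x,y),i+1\}$. A set $S\subseteq V(G)$ is an adjacency resolving set if for any two distinct $x,y$ there is $z\in S$ with $d_1(x,z)\neq d_1(y,z)$; $\mathrm{adim}(G)$ is the minimum cardinality of such a set. A function $f:V(G)\to\mathbb{Z}_{\ge0}$ is a resolving broadcast if for any two distinct $x,y$ there is $z$ with $f(z)=i>0$ and $d_i(x,z)\neq d_i(y,z)$; $\mathrm{bdim}(G)$ is the minimum of $\sum_{v}f(v)$ over all resolving broadcasts $f$ of $G$. -}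

module Defs where

open import Data.Nat using (ℕ; zero; suc; _⊓_; _<_; _≤_)
open import Data.Bool using (Bool; true; false)
open import Data.Fin using (Fin)
open import Data.Fin.Subset using (Subset; _∈_; ∣_∣)
open import Data.List using (List; map; allFin)
open import Data.Nat.ListAction using (sum)
open import Data.Product using (Σ; _×_)
open import Data.Sum using (_⊎_)
open import Relation.Nullary using (¬_)
open import Relation.Binary.PropositionalEquality using (_≡_; _≢_)

record Graph : Set where
  field
    n      : ℕ
    adj    : Fin n → Fin n → Bool
    sym    : ∀ x y → adj x y ≡ adj y x
    irrefl : ∀ x → adj x x ≡ false
open Graph public

data Walk (G : Graph) : Fin (n G) → Fin (n G) → ℕ → Set where
  here : ∀ {x} → Walk G x x zero
  step : ∀ {x y z k} → adj G x y ≡ true → Walk G y z k → Walk G x z (suc k)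

Dist : (G : Graph) → Fin (n G) → Fin (n G) → ℕ → Set
Dist G x y k = Walk G x y k × (∀ m → Walk G x y m → k ≤ m)

Disconnected : (G : Graph) → Fin (n G) → Fin (n G) → Set
Disconnected G x y = ∀ k → ¬ Walk G x y k

DistT : (G : Graph) → ℕ → Fin (n G) → Fin (n G) → ℕ → Set
DistT G i x y m =
  (Σ ℕ λ k → Dist G x y k × m ≡ k ⊓ suc i) ⊎ (Disconnected G x y × m ≡ suc i)

Distinguishes : (G : Graph) → ℕ → Fin (n G) → Fin (n G) → Fin (n G) → Set
Distinguishes G i z x y =
  Σ ℕ λ m → Σ ℕ λ m' → DistT G i x z m × DistT G i y z m' × m ≢ m'

HasDiameter : Graph → ℕ → Set
HasDiameter G d =
  (∀ x y → Σ ℕ λ k → Dist G x y k × k ≤ d) ×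
  (Σ (Fin (n G)) λ x → Σ (Fin (n G)) λ y → Dist G x y d)

IsAdjResolving : (G : Graph) → Subset (n G) → Set
IsAdjResolving G S =
  ∀ x y → x ≢ y → Σ (Fin (n G)) λ z → z ∈ S × Distinguishes G 1 z x y

IsAdim : Graph → ℕ → Set
IsAdim G a =
  (Σ (Subset (n G)) λ S → IsAdjResolving G S × ∣ S ∣ ≡ a) ×
  (∀ S → IsAdjResolving G S → a ≤ ∣ S ∣)

IsResolvingBroadcast : (G : Graph) → (Fin (n G) → ℕ) → Set
IsResolvingBroadcast G f =
  ∀ x y → x ≢ y → Σ (Fin (n G)) λ z → 0 < f z × Distinguishes G (f z) z x y

cost : (G : Graph) → (Fin (n G) → ℕ) → ℕ
cost G f = sum (map f (allFin (n G)))

IsBdim : Graph → ℕ → Set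
IsBdim G b =
  (Σ (Fin (n G) → ℕ) λ f → IsResolvingBroadcast G f × cost G f ≡ b) ×
  (∀ f → IsResolvingBroadcast G f → b ≤ cost G f)

module Submission where

-- The first inequality is immediate: the indicator function of an adjacency
-- resolving set S is a resolving broadcast of cost |S|.
--
-- For the second, take a resolving broadcast f and a shortest walk
-- v₀ v₁ … v_d between two vertices at distance d.  Say that z hears the
-- position m when f z > 0 and d(v_m, z) ≤ f z, and that m is covered when
-- some z hears it.  Two uncovered positions would be at truncated distance
-- f z + 1 from every broadcasting z, hence not resolved; so at least d of
-- the d + 1 positions are covered.  On the other hand, since the walk is a
-- geodesic, the positions heard by a fixed z lie in a window of width 2 f z,
-- so there are at most 2 f z + 1 ≤ 3 f z of them.  Double counting gives
-- d ≤ Σ_z 3 f z = 3 · cost(f).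

open import Defs
open import Algebra.Properties.CommutativeSemigroup using (interchange)
open import Data.Bool using (Bool; true; false) renaming (_≟_ to _≟ᵇ_)
open import Data.Empty using (⊥; ⊥-elim)
open import Data.Fin using (Fin) renaming (_≟_ to _≟ᶠ_)
open import Data.Fin.Properties using (any?)
open import Data.Fin.Subset using (Subset; ∣_∣)
open import Data.List using (List; []; _∷_; map; allFin; tabulate)
open import Data.List.Membership.Propositional using () renaming (_∈_ to _∈ₗ_)
open import Data.List.Membership.Propositional.Properties using (∈-allFin)
open import Data.List.Properties using (map-tabulate)
open import Data.List.Relation.Unary.Any using (here; there)
open import Data.Nat using (ℕ; zero; suc; _≤_; _<_; _+_; _*_; _∸_; z≤n; s≤s; s≤s⁻¹)
open import Data.Nat.ListAction using (sum)
open import Data.Nat.Properties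
open import Data.Nat.Tactic.RingSolver using (solve-∀)
open import Data.Product using (_×_; _,_; ∃; proj₁)
open import Data.Sum using (inj₁; inj₂)
open import Data.Vec using (Vec; lookup) renaming ([] to []ᵛ; _∷_ to _∷ᵛ_)
open import Data.Vec.Properties using ([]=⇒lookup)
open import Relation.Nullary using (¬_; Dec; yes; no; does; ¬?)
open import Relation.Nullary.Decidable using (_×-dec_)
open import Relation.Unary using (Decidable)
open import Relation.Binary.PropositionalEquality
  using (_≡_; _≢_; refl; trans; cong; cong₂; subst; module ≡-Reasoning)
  renaming (sym to sym≡)

sumBelow : ℕ → (ℕ → ℕ) → ℕ
sumBelow zero    g = 0
sumBelow (suc N) g = sumBelow N g + g N

sumBelow-mono : ∀ N {g h : ℕ → ℕ} → (∀ m → g m ≤ h m) → sumBelow N g ≤ sumBelow N h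
sumBelow-mono zero    g≤h = z≤n
sumBelow-mono (suc N) g≤h = +-mono-≤ (sumBelow-mono N g≤h) (g≤h N)

sumBelow-zero : ∀ N → sumBelow N (λ _ → 0) ≡ 0
sumBelow-zero zero    = refl
sumBelow-zero (suc N) = trans (+-identityʳ _) (sumBelow-zero N)

sumBelow-+ : ∀ N (g h : ℕ → ℕ) →
             sumBelow N (λ m → g m + h m) ≡ sumBelow N g + sumBelow N h
sumBelow-+ zero    g h = refl
sumBelow-+ (suc N) g h =
  trans (cong (_+ (g N + h N)) (sumBelow-+ N g h))
        (interchange +-commutativeSemigroup (sumBelow N g) (sumBelow N h) (g N) (h N))

module _ {A : Set} where

  sumBelow-sum-comm : ∀ N (h : A → ℕ → ℕ) (L : List A) →
    sumBelow N (λ m → sum (map (λ z → h z m) L)) ≡ sum (map (λ z → sumBelow N (h z)) L)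
  sumBelow-sum-comm N h []      = sumBelow-zero N
  sumBelow-sum-comm N h (z ∷ L) =
    trans (sumBelow-+ N (h z) (λ m → sum (map (λ z → h z m) L)))
          (cong (sumBelow N (h z) +_) (sumBelow-sum-comm N h L))

  sum-mono : ∀ (g h : A → ℕ) (L : List A) → (∀ z → g z ≤ h z) →
             sum (map g L) ≤ sum (map h L)
  sum-mono g h []      g≤h = z≤n
  sum-mono g h (z ∷ L) g≤h = +-mono-≤ (g≤h z) (sum-mono g h L g≤h)

  term≤sum : ∀ (g : A → ℕ) {z} (L : List A) → z ∈ₗ L → g z ≤ sum (map g L)
  term≤sum g (z ∷ L) (here refl) = m≤m+n (g z) _
  term≤sum g (y ∷ L) (there z∈L) = ≤-trans (term≤sum g L z∈L) (m≤n+m _ (g y))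

  sum-*ˡ : ∀ k (g : A → ℕ) (L : List A) → sum (map (λ z → k * g z) L) ≡ k * sum (map g L)
  sum-*ˡ k g []      = sym≡ (*-zeroʳ k)
  sum-*ˡ k g (z ∷ L) =
    trans (cong (k * g z +_) (sum-*ˡ k g L)) (sym≡ (*-distribˡ-+ k (g z) (sum (map g L))))

bit : Bool → ℕ
bit true  = 1
bit false = 0

indicator : ∀ {A : Set} → Dec A → ℕ
indicator a? = bit (does a?)

indicator-yes : ∀ {A : Set} (a? : Dec A) → A → indicator a? ≡ 1
indicator-yes (yes _) _ = refl
indicator-yes (no ¬a) a = ⊥-elim (¬a a)

indicator-no : ∀ {A : Set} (a? : Dec A) → ¬ A → indicator a? ≡ 0
indicator-no (yes a) ¬a = ⊥-elim (¬a a)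
indicator-no (no _)  _  = refl

indicator-any≤sum : ∀ {k} {P : Fin k → Set} (P? : Decidable P) →
  indicator (any? P?) ≤ sum (map (λ z → indicator (P? z)) (allFin k))
indicator-any≤sum {k} P? with any? P?
... | yes (z , Pz) = subst (_≤ sum (map (λ z → indicator (P? z)) (allFin k)))
                           (indicator-yes (P? z) Pz)
                           (term≤sum (λ z → indicator (P? z)) (allFin k) (∈-allFin z))
... | no _ = z≤n

module Counting {P : ℕ → Set} (P? : Decidable P) where

  count : ℕ → ℕ
  count N = sumBelow N (λ m → indicator (P? m))

  count-suc-yes : ∀ {N} → P N → count (suc N) ≡ suc (count N)
  count-suc-yes {N} PN = trans (cong (count N +_) (indicator-yes (P? N) PN)) (+-comm (count N) 1)

  count-suc-no : ∀ {N} → ¬ P N → count (suc N) ≡ count N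
  count-suc-no {N} ¬PN = trans (cong (count N +_) (indicator-no (P? N) ¬PN)) (+-identityʳ (count N))

  count-recent : ∀ (L N : ℕ) → (∀ m → m < N → P m → N ≤ m + L) → count N ≤ L
  count-recent L zero _ = z≤n
  count-recent L (suc N) recent = by-last (P? N) L recent
    where
      -- L is passed along so that it can be split when P holds at N.
      by-last : Dec (P N) → ∀ ℓ → (∀ m → m < suc N → P m → suc N ≤ m + ℓ) → count (suc N) ≤ ℓ
      by-last (no ¬PN) ℓ recent′ =
        ≤-trans (≤-reflexive (count-suc-no ¬PN))
                (count-recent ℓ N λ m m<N Pm → ≤-trans (n≤1+n N) (recent′ m (m<n⇒m<1+n m<N) Pm))
      by-last (yes PN) zero recent′ =
        ⊥-elim (1+n≰n (subst (suc N ≤_) (+-identityʳ N) (recent′ N ≤-refl PN)))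
      by-last (yes PN) (suc ℓ) recent′ =
        ≤-trans (≤-reflexive (count-suc-yes PN))
                (s≤s (count-recent ℓ N λ m m<N Pm →
                  s≤s⁻¹ (subst (suc N ≤_) (+-suc m ℓ) (recent′ m (m<n⇒m<1+n m<N) Pm))))

  -- If all positions below N satisfying P lie in a window of width D,
  -- at most D + 1 of them satisfy P: look at the last one.
  count-window : ∀ (D N : ℕ) → (∀ j k → j ≤ k → k < N → P j → P k → k ≤ j + D) →
                 count N ≤ suc D
  count-window D zero _ = z≤n
  count-window D (suc N) window = by-last (P? N)
    where
      by-last : Dec (P N) → count (suc N) ≤ suc D
      by-last (no ¬PN) = ≤-trans (≤-reflexive (count-suc-no ¬PN))
                                 (count-window D N λ j k j≤k k<N → window j k j≤k (m<n⇒m<1+n k<N))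
      by-last (yes PN) = count-recent (suc D) (suc N) λ m m<1+N Pm →
        subst (suc N ≤_) (sym≡ (+-suc m D)) (s≤s (window m N (s≤s⁻¹ m<1+N) ≤-refl Pm PN))

open Counting using (count; count-suc-yes; count-suc-no; count-recent; count-window)

count-complement : ∀ {P : ℕ → Set} (P? : Decidable P) N →
                   count P? N + count (λ m → ¬? (P? m)) N ≡ N
count-complement P? zero = refl
count-complement {P} P? (suc N) = by-last (P? N)
  where
    open ≡-Reasoning
    ¬P? : Decidable (λ m → ¬ P m)
    ¬P? m = ¬? (P? m)
    by-last : Dec (P N) → count P? (suc N) + count ¬P? (suc N) ≡ suc N
    by-last (yes PN) = begin
      count P? (suc N) + count ¬P? (suc N)
        ≡⟨ cong₂ _+_ (count-suc-yes P? PN) (count-suc-no ¬P? (λ ¬PN → ¬PN PN)) ⟩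
      suc (count P? N + count ¬P? N) ≡⟨ cong suc (count-complement P? N) ⟩
      suc N ∎
    by-last (no ¬PN) = begin
      count P? (suc N) + count ¬P? (suc N)
        ≡⟨ cong₂ _+_ (count-suc-no P? ¬PN) (count-suc-yes ¬P? ¬PN) ⟩
      count P? N + suc (count ¬P? N) ≡⟨ +-suc (count P? N) _ ⟩
      suc (count P? N + count ¬P? N) ≡⟨ cong suc (count-complement P? N) ⟩
      suc N ∎

count-all-but-one : ∀ {P : ℕ → Set} (P? : Decidable P) N →
  (∀ j k → j < k → k < N → ¬ P j → ¬ P k → ⊥) → N ≤ suc (count P? N)
count-all-but-one {P} P? N unique = begin
    N                                         ≡⟨ sym≡ (count-complement P? N) ⟩
    count P? N + count (λ m → ¬? (P? m)) N    ≤⟨ +-monoʳ-≤ (count P? N) at-most-one-failure ⟩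
    count P? N + 1                            ≡⟨ +-comm (count P? N) 1 ⟩
    suc (count P? N)                          ∎
  where
    open ≤-Reasoning
    failures-coincide : ∀ j k → j ≤ k → k < N → ¬ P j → ¬ P k → k ≤ j + 0
    failures-coincide j k j≤k k<N ¬Pj ¬Pk with m≤n⇒m<n∨m≡n j≤k
    ... | inj₁ j<k  = ⊥-elim (unique j k j<k k<N ¬Pj ¬Pk)
    ... | inj₂ refl = ≤-reflexive (sym≡ (+-identityʳ j))
    at-most-one-failure : count (λ m → ¬? (P? m)) N ≤ 1
    at-most-one-failure = count-window (λ m → ¬? (P? m)) 0 N failures-coincide

≤-triple : ∀ c i → c ≤ suc (i + i) → (i ≡ 0 → c ≤ 0) → c ≤ 3 * i
≤-triple c zero    _      small = small refl
≤-triple c (suc i) c≤2i+1 _     =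
  ≤-trans c≤2i+1 (≤-trans (m≤m+n _ i) (≤-reflexive (identity i)))
  where
    identity : ∀ i → suc (suc i + suc i) + i ≡ 3 * suc i
    identity = solve-∀

module Walks (G : Graph) where

  Vertex : Set
  Vertex = Fin (n G)

  snoc : ∀ {x y z k} → Walk G x y k → adj G y z ≡ true → Walk G x z (suc k)
  snoc here       yz = step yz here
  snoc (step e w) yz = step e (snoc w yz)

  reverse : ∀ {x y k} → Walk G x y k → Walk G y x k
  reverse here                 = here
  reverse (step {x} {y} xy w) = snoc (reverse w) (trans (Graph.sym G y x) xy)

  _++ʷ_ : ∀ {x y z a b} → Walk G x y a → Walk G y z b → Walk G x z (a + b)
  here     ++ʷ v = v
  step e w ++ʷ v = step e (w ++ʷ v)

  -- The vertex in position m of a walk (its end once m exceeds its length).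
  vertexAt : ∀ {x y k} → Walk G x y k → ℕ → Vertex
  vertexAt {x} w          zero    = x
  vertexAt {x} here       (suc m) = x
  vertexAt     (step _ w) (suc m) = vertexAt w m

  prefix : ∀ {x y k} (w : Walk G x y k) m → m ≤ k → Walk G x (vertexAt w m) m
  prefix w          zero    _         = here
  prefix (step e w) (suc m) (s≤s m≤k) = step e (prefix w m m≤k)

  suffix : ∀ {x y k} (w : Walk G x y k) m → m ≤ k → Walk G (vertexAt w m) y (k ∸ m)
  suffix w          zero    _         = w
  suffix (step e w) (suc m) (s≤s m≤k) = suffix w m m≤k

  geodesic-subpath : ∀ {x y d} (D : Dist G x y d) j k L → j ≤ k → k ≤ d →
    Walk G (vertexAt (proj₁ D) j) (vertexAt (proj₁ D) k) L → k ≤ j + L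
  geodesic-subpath {d = d} (w , shortest) j k L j≤k k≤d u =
    +-cancelʳ-≤ (d ∸ k) k (j + L) (begin
      k + (d ∸ k)     ≡⟨ m+[n∸m]≡n k≤d ⟩
      d               ≤⟨ shortest _ (prefix w j (≤-trans j≤k k≤d) ++ʷ (u ++ʷ suffix w k k≤d)) ⟩
      j + (L + (d ∸ k)) ≡⟨ sym≡ (+-assoc j L (d ∸ k)) ⟩
      j + L + (d ∸ k) ∎)
    where open ≤-Reasoning

  geodesic-injective : ∀ {x y d} (D : Dist G x y d) {j k} → j < k → k ≤ d →
    vertexAt (proj₁ D) j ≢ vertexAt (proj₁ D) k
  geodesic-injective D {j} {k} j<k k≤d same =
    <⇒≱ j<k (≤-trans (geodesic-subpath D j k 0 (<⇒≤ j<k) k≤d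
                        (subst (λ v → Walk G (vertexAt (proj₁ D) j) v 0) same here))
                     (≤-reflexive (+-identityʳ j)))

  walk? : ∀ k x y → Dec (Walk G x y k)
  walk? zero x y with x ≟ᶠ y
  ... | yes refl = yes here
  ... | no x≢y   = no λ { here → x≢y refl }
  walk? (suc k) x y with any? (λ x' → (adj G x x' ≟ᵇ true) ×-dec walk? k x' y)
  ... | yes (x' , e , w) = yes (step e w)
  ... | no none          = no λ { (step {y = x'} e w) → none (x' , e , w) }

  Within : ℕ → Vertex → Vertex → Set
  Within i x z = ∃ λ k → k < suc i × Walk G x z k

  within? : ∀ i x z → Dec (Within i x z)
  within? i x z = anyUpTo? (λ k → walk? k x z) (suc i)

  truncated-beyond : ∀ i x z m → ¬ Within i x z → DistT G i x z m → m ≡ suc i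
  truncated-beyond i x z m far (inj₁ (k , (w , _) , m≡k⊓1+i)) with k ≤? i
  ... | yes k≤i = ⊥-elim (far (k , s≤s k≤i , w))
  ... | no  k≰i = trans m≡k⊓1+i (m≥n⇒m⊓n≡n (≰⇒> k≰i))
  truncated-beyond i x z m far (inj₂ (_ , m≡1+i)) = m≡1+i

module DiameterBound (G : Graph) (f : Fin (n G) → ℕ) (resolving : IsResolvingBroadcast G f)
                     {x y : Fin (n G)} {d : ℕ} (geodesic : Dist G x y d) where
  open Walks G

  vertices : List Vertex
  vertices = allFin (n G)

  v : ℕ → Vertex
  v = vertexAt (proj₁ geodesic)

  Hears : Vertex → ℕ → Set
  Hears z m = 0 < f z × Within (f z) (v m) z

  hears? : ∀ z → Decidable (Hears z)
  hears? z m = (0 <? f z) ×-dec within? (f z) (v m) z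

  Covered : ℕ → Set
  Covered m = ∃ λ z → Hears z m

  covered? : Decidable Covered
  covered? m = any? (λ z → hears? z m)

  -- Two uncovered positions have the same truncated distance to every
  -- broadcasting vertex, so the broadcast would not resolve them.
  uncovered-unique : ∀ j k → j < k → k < suc d → ¬ Covered j → ¬ Covered k → ⊥
  uncovered-unique j k j<k k<1+d silent-j silent-k
    with resolving (v j) (v k) (geodesic-injective geodesic j<k (s≤s⁻¹ k<1+d))
  ... | z , f>0 , (m , m' , dj , dk , m≢m') =
    m≢m' (trans (truncated-beyond (f z) (v j) z m (λ near → silent-j (z , f>0 , near)) dj)
                (sym≡ (truncated-beyond (f z) (v k) z m' (λ near → silent-k (z , f>0 , near)) dk)))

  covered-count : d ≤ count covered? (suc d)
  covered-count = s≤s⁻¹ (count-all-but-one covered? (suc d) uncovered-unique)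

  -- The positions heard by z lie in a window of width 2 f z, since the
  -- geodesic cannot be shortcut through z.
  hears-count : ∀ z → count (hears? z) (suc d) ≤ 3 * f z
  hears-count z = ≤-triple _ (f z) (count-window (hears? z) (f z + f z) (suc d) window) silent
    where
      window : ∀ j k → j ≤ k → k < suc d → Hears z j → Hears z k → k ≤ j + (f z + f z)
      window j k j≤k k<1+d (_ , a , a<1+fz , wa) (_ , b , b<1+fz , wb) =
        ≤-trans (geodesic-subpath geodesic j k (a + b) j≤k (s≤s⁻¹ k<1+d) (wa ++ʷ reverse wb))
                (+-monoʳ-≤ j (+-mono-≤ (s≤s⁻¹ a<1+fz) (s≤s⁻¹ b<1+fz)))
      silent : f z ≡ 0 → count (hears? z) (suc d) ≤ 0
      silent fz≡0 = count-recent (hears? z) 0 (suc d)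
        λ m _ (f>0 , _) → ⊥-elim (<-irrefl (sym≡ fz≡0) f>0)

  diameter-bound : d ≤ 3 * cost G f
  diameter-bound = begin
    d                                                    ≤⟨ covered-count ⟩
    count covered? (suc d)                               ≤⟨ sumBelow-mono (suc d) covered≤hearers ⟩
    sumBelow (suc d) (λ m → sum (map (hearer m) vertices)) ≡⟨ sumBelow-sum-comm (suc d) (λ z m → hearer m z) vertices ⟩
    sum (map (λ z → count (hears? z) (suc d)) vertices)  ≤⟨ sum-mono _ _ vertices hears-count ⟩
    sum (map (λ z → 3 * f z) vertices)                   ≡⟨ sum-*ˡ 3 f vertices ⟩
    3 * cost G f                                         ∎
    where
      open ≤-Reasoning
      hearer : ℕ → Vertex → ℕ
      hearer m z = indicator (hears? z m)
      covered≤hearers : ∀ m → indicator (covered? m) ≤ sum (map (hearer m) vertices)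
      covered≤hearers m = indicator-any≤sum (λ z → hears? z m)

indicatorBroadcast : (G : Graph) → Subset (n G) → Fin (n G) → ℕ
indicatorBroadcast G S z = bit (lookup S z)

-- With every broadcast value equal to 1, d_1 is the adjacency distance, so
-- an adjacency resolving set yields a resolving broadcast.
adjacency-resolving⇒broadcast : ∀ G S → IsAdjResolving G S →
                                IsResolvingBroadcast G (indicatorBroadcast G S)
adjacency-resolving⇒broadcast G S resolving x y x≢y with resolving x y x≢y
... | z , z∈S , distinguishes =
  z , subst (λ b → 0 < bit b × Distinguishes G (bit b) z x y)
            (sym≡ ([]=⇒lookup z∈S)) (s≤s z≤n , distinguishes)

sum-bits : ∀ {k} (S : Vec Bool k) → sum (tabulate (λ z → bit (lookup S z))) ≡ ∣ S ∣
sum-bits []ᵛ          = refl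
sum-bits (true ∷ᵛ S)  = cong suc (sum-bits S)
sum-bits (false ∷ᵛ S) = sum-bits S

indicatorBroadcast-cost : ∀ G S → cost G (indicatorBroadcast G S) ≡ ∣ S ∣
indicatorBroadcast-cost G S =
  trans (cong sum (map-tabulate (λ z → z) (indicatorBroadcast G S))) (sum-bits S)

proposition3p13 : (G : Graph) (d a b : ℕ) → HasDiameter G d → IsAdim G a → IsBdim G b
                  → b ≤ a × d ≤ 3 * b
proposition3p13 G d a b (_ , x , y , diametral)
                ((S , S-resolving , ∣S∣≡a) , _) ((f , f-resolving , cost≡b) , bdim-minimal) =
  b≤a , d≤3b
  where
    open ≤-Reasoning
    b≤a : b ≤ a
    b≤a = begin
      b                                   ≤⟨ bdim-minimal (indicatorBroadcast G S)
                                               (adjacency-resolving⇒broadcast G S S-resolving) ⟩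
      cost G (indicatorBroadcast G S)     ≡⟨ indicatorBroadcast-cost G S ⟩
      ∣ S ∣                               ≡⟨ ∣S∣≡a ⟩
      a                                   ∎
    d≤3b : d ≤ 3 * b
    d≤3b = subst (λ c → d ≤ 3 * c) cost≡b (DiameterBound.diameter-bound G f f-resolving diametral)
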